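{- Let $n\ge 6$ be even, and let $d_*=(\epsilon_1,\dots,\epsilon_{n-1},h)$ and $d_*'=(\epsilon_1',\dots,\epsilon_{n-1}',h')$ be non-equal neighbors. Then for all $j_1,j_2$ with $1\le j_1\le j_2\le n-1$, \[\left|\sum_{j=j_1}^{j_2}(\epsilon'_j-\epsilon_j)\right|\le 2.\] Further, either $|h-h'|\le 2$, or $|h|=\frac n2-1$ and $h'=-h$.
   Context: $\mathrm{dist}(a,b)$ is the minimum of the residues in $[0,n-1]$ of $a-b$ and $b-a$ mod $n$. A Latin row $(s_1,\dots,s_n)$ is a permutation of $[1,n]$; it is normal if $s_1=1$ and has maximum inner distance if $\mathrm{dist}(s_j,s_{j+1})\ge\frac n2-1$ for $j\le n-1$. With $h_j\in[0,n-1]$, $h_j\equiv s_{j+1}-s_j$ ($j\le n-1$), $h_n\in[0,n-1]$, $h_n\equiv s_1-s_n$, the extended difference row is $(\epsilon_1,\dots,\epsilon_{n-1},h)$ with $\epsilon_j=h_j-\frac n2$, $h=h_n-\frac n2$ (integers). Two extended difference rows $d_*,d_*'$ of normal rows $r,r'$ of maximum inner distance are neighbors if some additions of $r$ and $r'$ (adding a constant to all entries mod $n$) stacked as two rows form a $2\times n$ Latin rectangle (no symbol repeated in a row or column) in which every pair of horizontally or vertically adjacent symbols has distance at least $\frac n2-1$. -}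

module Defs where

open import Data.Nat as ℕ using (ℕ; zero; suc; _≤_; _∸_; _⊔_; _⊓_; NonZero)
open import Data.Nat.DivMod using (_/_)
open import Data.Integer as ℤ using (ℤ; +_; _-_; -_)
open import Data.Integer.DivMod using (_%ℕ_)
open import Data.Product using (_×_; Σ; ∃; ∃-syntax)
open import Relation.Binary.PropositionalEquality using (_≡_; _≢_)

-- Rows are indexed by positions j ∈ [1,n] (ℕ-indexed functions; only the
-- values at positions 1..n matter).  Symbols are natural numbers in [1,n].
Row : Set
Row = ℕ → ℕ

res : (n : ℕ) .{{_ : NonZero n}} → ℤ → ℕ
res n x = x %ℕ n

dist : (n : ℕ) .{{_ : NonZero n}} → ℤ → ℤ → ℕ
dist n a b = res n (a - b) ⊓ res n (b - a)

LatinRow : ℕ → Row → Set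
LatinRow n s =
  (∀ j → 1 ≤ j → j ≤ n → 1 ≤ s j × s j ≤ n) ×
  (∀ i j → 1 ≤ i → i ≤ n → 1 ≤ j → j ≤ n → s i ≡ s j → i ≡ j)

Normal : Row → Set
Normal s = s 1 ≡ 1

MaxInnerDist : (n : ℕ) .{{_ : NonZero n}} → Row → Set
MaxInnerDist n s = ∀ j → 1 ≤ j → j ≤ n ∸ 1 →
  n / 2 ∸ 1 ≤ dist n (+ s j) (+ s (suc j))

hDiff : (n : ℕ) .{{_ : NonZero n}} → Row → ℕ → ℕ
hDiff n s j = res n (+ s (suc j) - + s j)

eps : (n : ℕ) .{{_ : NonZero n}} → Row → ℕ → ℤ
eps n s j = + hDiff n s j - + (n / 2)

hLast : (n : ℕ) .{{_ : NonZero n}} → Row → ℤ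
hLast n s = + res n (+ s 1 - + s n) - + (n / 2)

SameExtDiff : (n : ℕ) .{{_ : NonZero n}} → Row → Row → Set
SameExtDiff n r r' =
  (∀ j → 1 ≤ j → j ≤ n ∸ 1 → eps n r j ≡ eps n r' j) × hLast n r ≡ hLast n r'

-- addition of a constant c to all entries (mod n), as integers; only
-- residues mod n matter for dist and for repetition of symbols
addC : Row → ℕ → ℕ → ℤ
addC s c j = + (s j ℕ.+ c)

-- the additions r+c, r'+c' stacked form a 2×n Latin rectangle in which all
-- horizontally/vertically adjacent symbols have distance ≥ n/2 - 1.
-- (Rows remain permutations and horizontal distances are unchanged under
-- addition; we nonetheless state all conditions explicitly.)
GoodRectangle : (n : ℕ) .{{_ : NonZero n}} → Row → Row → ℕ → ℕ → Set
GoodRectangle n r r' c c' =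
  (∀ i j → 1 ≤ i → i ≤ n → 1 ≤ j → j ≤ n →
     res n (addC r c i) ≡ res n (addC r c j) → i ≡ j) ×
  (∀ i j → 1 ≤ i → i ≤ n → 1 ≤ j → j ≤ n →
     res n (addC r' c' i) ≡ res n (addC r' c' j) → i ≡ j) ×
  (∀ j → 1 ≤ j → j ≤ n → res n (addC r c j) ≢ res n (addC r' c' j)) ×
  (∀ j → 1 ≤ j → j ≤ n ∸ 1 → n / 2 ∸ 1 ≤ dist n (addC r c j) (addC r c (suc j))) ×
  (∀ j → 1 ≤ j → j ≤ n ∸ 1 → n / 2 ∸ 1 ≤ dist n (addC r' c' j) (addC r' c' (suc j))) ×
  (∀ j → 1 ≤ j → j ≤ n → n / 2 ∸ 1 ≤ dist n (addC r c j) (addC r' c' j))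

-- the extended difference rows of normal rows r, r' of maximum inner
-- distance are neighbors
Neighbors : (n : ℕ) .{{_ : NonZero n}} → Row → Row → Set
Neighbors n r r' =
  LatinRow n r × Normal r × MaxInnerDist n r ×
  LatinRow n r' × Normal r' × MaxInnerDist n r' ×
  ∃[ c ] ∃[ c' ] (c ℕ.< n × c' ℕ.< n × GoodRectangle n r r' c c')

-- Σ_{j=a}^{b} f j  (empty if b < a)
sumFrom : ℕ → ℕ → (ℕ → ℤ) → ℤ
sumFrom a zero f = + 0
sumFrom a (suc k) f = f a ℤ.+ sumFrom (suc a) k f

sumRange : ℕ → ℕ → (ℕ → ℤ) → ℤ
sumRange a b f = sumFrom a (suc b ∸ a) f

{-# OPTIONS --safe #-}
module Submission where

-- Write n = 2(b + 1). The distance conditions force every horizontal difference hⱼ of both rows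
-- and every vertical difference Dⱼ ≡ (r'ⱼ + c') − (rⱼ + c) into [b, b + 2]. Going around a unit
-- square of the rectangle gives h'ⱼ + Dⱼ ≡ hⱼ + Dⱼ₊₁ (mod n); both sides lie in [2b, 2b + 4], an
-- interval shorter than n, so they are equal, ε'ⱼ − εⱼ = Dⱼ₊₁ − Dⱼ, and partial sums telescope to
-- a difference of two D's. For the closing square (columns n and 1) the differences hₙ, h'ₙ only
-- lie in [1, n − 1]: the congruence is then either an equality, giving |h − h'| ≤ 2, or it wraps
-- around by n, which forces {hₙ, h'ₙ} = {1, n − 1}.

open import Data.Nat as ℕ
  using (ℕ; zero; suc; _≤_; _<_; _∸_; NonZero; z≤n; s≤s; _+_; _*_)
import Data.Nat.Properties as ℕP
open import Data.Nat.DivMod using (_/_; m*n/n≡m)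
open import Data.Nat.Divisibility using (_∣_; divides)
import Data.Nat.Divisibility as ℕ∣
open import Data.Integer as ℤ using (ℤ; +_; _-_; -_; ∣_∣) renaming (_+_ to _+ℤ_; _*_ to _*ℤ_)
import Data.Integer.Properties as ℤP
open import Data.Integer.DivMod using (_/ℕ_; a≡a%ℕn+[a/ℕn]*n; n%ℕd<d)
open import Data.Integer.Divisibility.Signed
  using (∣⇒∣ᵤ; ∣m⇒∣-m; ∣m∣n⇒∣m+n) renaming (_∣_ to _∣ℤ_; divides to dividesℤ)
open import Data.Integer.Tactic.RingSolver using (solve-∀)
import Data.Nat.Tactic.RingSolver as ℕSolver
open import Data.Product using (_×_; _,_; proj₁; proj₂)
open import Data.Sum using (_⊎_; inj₁; inj₂)
open import Function using (_$_; case_of_)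
open import Level using (0ℓ)
open import Relation.Binary.Bundles using (Setoid)
open import Relation.Binary.PropositionalEquality
open import Relation.Nullary using (¬_; contradiction)
open import Relation.Binary.Definitions using (tri<; tri≈; tri>)
import Relation.Binary.Reasoning.Setoid

open import Defs

infix 4 _≡_mod_

-- A record rather than a synonym for divisibility, so that i and j can be inferred.
record _≡_mod_ (i j : ℤ) (n : ℕ) : Set where
  constructor mod-divides
  field n∣i-j : + n ∣ℤ i - j

module _ {n : ℕ} where

  ≡⇒≡-mod : ∀ {i j} → i ≡ j → i ≡ j mod n
  ≡⇒≡-mod {i} refl = mod-divides (dividesℤ (+ 0) (trans (ℤP.+-inverseʳ i) (sym (ℤP.*-zeroˡ (+ n)))))

  ≡-mod-sym : ∀ {i j} → i ≡ j mod n → j ≡ i mod n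
  ≡-mod-sym {i} {j} (mod-divides n∣i-j) = mod-divides $ subst (+ n ∣ℤ_) (negate i j) (∣m⇒∣-m n∣i-j)
    where
    negate : ∀ i j → - (i - j) ≡ j - i
    negate = solve-∀

  ≡-mod-trans : ∀ {i j k} → i ≡ j mod n → j ≡ k mod n → i ≡ k mod n
  ≡-mod-trans {i} {j} {k} (mod-divides n∣i-j) (mod-divides n∣j-k) =
    mod-divides $ subst (+ n ∣ℤ_) (ℤP.+-minus-telescope i j k) (∣m∣n⇒∣m+n n∣i-j n∣j-k)

  ≡-mod-+ : ∀ {i j k l} → i ≡ j mod n → k ≡ l mod n → i +ℤ k ≡ j +ℤ l mod n
  ≡-mod-+ {i} {j} {k} {l} (mod-divides n∣i-j) (mod-divides n∣k-l) =
    mod-divides $ subst (+ n ∣ℤ_) (regroup i j k l) (∣m∣n⇒∣m+n n∣i-j n∣k-l)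
    where
    regroup : ∀ i j k l → (i - j) +ℤ (k - l) ≡ (i +ℤ k) - (j +ℤ l)
    regroup = solve-∀

mod-setoid : ℕ → Setoid 0ℓ 0ℓ
mod-setoid n = record
  { Carrier = ℤ
  ; _≈_ = _≡_mod n
  ; isEquivalence = record
    { refl = ≡⇒≡-mod refl ; sym = ≡-mod-sym ; trans = ≡-mod-trans }
  }

module _ {n : ℕ} where

  ≡-mod-gap : ∀ {x y} → x < y → + x ≡ + y mod n → n + x ≤ y
  ≡-mod-gap {x} {y} x<y (mod-divides n∣x-y) = ℕP.m≤o∸n⇒m+n≤o n (ℕP.<⇒≤ x<y) (ℕ∣.∣⇒≤ n∣y∸x)
    where
    instance
      y∸x≢0 : NonZero (y ∸ x)
      y∸x≢0 = ℕ.>-nonZero (ℕP.m<n⇒0<n∸m x<y)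
    ∣x-y∣≡y∸x : ∣ + x - + y ∣ ≡ y ∸ x
    ∣x-y∣≡y∸x = trans (cong ∣_∣ (ℤP.[+m]-[+n]≡m⊖n x y)) (ℤP.∣⊖∣-< x<y)
    n∣y∸x : n ∣ y ∸ x
    n∣y∸x = subst (n ∣_) ∣x-y∣≡y∸x (∣⇒∣ᵤ n∣x-y)

  ≡-mod-ℕ-cases : ∀ {x y} → + x ≡ + y mod n → x ≡ y ⊎ n + y ≤ x ⊎ n + x ≤ y
  ≡-mod-ℕ-cases {x} {y} x≡y with ℕP.<-cmp x y
  ... | tri< x<y _ _ = inj₂ (inj₂ (≡-mod-gap x<y x≡y))
  ... | tri≈ _ x≡y _ = inj₁ x≡y
  ... | tri> _ _ y<x = inj₂ (inj₁ (≡-mod-gap y<x (≡-mod-sym x≡y)))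

  ≡-mod-ℕ-close : ∀ {x y} → + x ≡ + y mod n → x < n + y → y < n + x → x ≡ y
  ≡-mod-ℕ-close x≡y x<n+y y<n+x with ≡-mod-ℕ-cases x≡y
  ... | inj₁ x≡y = x≡y
  ... | inj₂ (inj₁ n+y≤x) = contradiction n+y≤x (ℕP.<⇒≱ x<n+y)
  ... | inj₂ (inj₂ n+x≤y) = contradiction n+x≤y (ℕP.<⇒≱ y<n+x)

module _ {n : ℕ} .{{_ : NonZero n}} where

  res-≡-mod : ∀ i → + res n i ≡ i mod n
  res-≡-mod i = mod-divides $ dividesℤ (- (i /ℕ n)) $ begin
    + res n i - i                               ≡⟨ cong (λ j → + res n i - j) (a≡a%ℕn+[a/ℕn]*n i n) ⟩
    + res n i - (+ res n i +ℤ (i /ℕ n) *ℤ + n)  ≡⟨ cancel (+ res n i) (i /ℕ n) (+ n) ⟩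
    - (i /ℕ n) *ℤ + n                           ∎
    where
    open ≡-Reasoning
    cancel : ∀ r q m → r - (r +ℤ q *ℤ m) ≡ - q *ℤ m
    cancel = solve-∀

  res≡0⇒≡-mod : ∀ i j → res n (i - j) ≡ 0 → i ≡ j mod n
  res≡0⇒≡-mod i j res≡0 = mod-divides $ dividesℤ ((i - j) /ℕ n) $ begin
    i - j                                     ≡⟨ a≡a%ℕn+[a/ℕn]*n (i - j) n ⟩
    + res n (i - j) +ℤ ((i - j) /ℕ n) *ℤ + n  ≡⟨ cong (λ m → + m +ℤ ((i - j) /ℕ n) *ℤ + n) res≡0 ⟩
    + 0 +ℤ ((i - j) /ℕ n) *ℤ + n              ≡⟨ ℤP.+-identityˡ (((i - j) /ℕ n) *ℤ + n) ⟩
    ((i - j) /ℕ n) *ℤ + n                     ∎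
    where open ≡-Reasoning

  res<n : ∀ i → res n i < n
  res<n i = n%ℕd<d i n

  n≡0-mod : + n ≡ + 0 mod n
  n≡0-mod = mod-divides (dividesℤ (+ 1) (trans (ℤP.+-identityʳ (+ n)) (sym (ℤP.*-identityˡ (+ n)))))

  res-+-res-swap≤n : ∀ i j → res n (i - j) + res n (j - i) ≤ n
  res-+-res-swap≤n i j with ≡-mod-ℕ-cases sum≡n
    where
    open Relation.Binary.Reasoning.Setoid (mod-setoid n)
    sum≡n : + (res n (i - j) + res n (j - i)) ≡ + n mod n
    sum≡n = begin
      + (res n (i - j) + res n (j - i))   ≡⟨ ℤP.pos-+ (res n (i - j)) (res n (j - i)) ⟩
      + res n (i - j) +ℤ + res n (j - i)  ≈⟨ ≡-mod-+ (res-≡-mod (i - j)) (res-≡-mod (j - i)) ⟩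
      (i - j) +ℤ (j - i)                  ≡⟨ cancel i j ⟩
      + 0                                 ≈⟨ ≡-mod-sym n≡0-mod ⟩
      + n                                 ∎
      where
      cancel : ∀ i j → (i - j) +ℤ (j - i) ≡ + 0
      cancel = solve-∀
  ... | inj₁ sum≡n = ℕP.≤-reflexive sum≡n
  ... | inj₂ (inj₁ n+n≤sum) = contradiction n+n≤sum (ℕP.<⇒≱ (ℕP.+-mono-< (res<n (i - j)) (res<n (j - i))))
  ... | inj₂ (inj₂ n+sum≤n) = ℕP.m+n≤o⇒n≤o n n+sum≤n

  dist≥⇒res-range : ∀ {b} a a' → b ≤ dist n a a' → b ≤ res n (a' - a) × res n (a' - a) + b ≤ n
  dist≥⇒res-range {b} a a' b≤dist = b≤y , (begin
    y + b  ≤⟨ ℕP.+-monoʳ-≤ y (ℕP.m≤n⊓o⇒m≤n x y b≤dist) ⟩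
    y + x  ≡⟨ ℕP.+-comm y x ⟩
    x + y  ≤⟨ res-+-res-swap≤n a a' ⟩
    n      ∎)
    where
    open ℕP.≤-Reasoning
    x y : ℕ
    x = res n (a - a')
    y = res n (a' - a)
    b≤y : b ≤ y
    b≤y = ℕP.m≤n⊓o⇒m≤o x y b≤dist

latin-gap-pos : ∀ {n} .{{_ : NonZero n}} {s} → LatinRow n s → ∀ {i j} →
  1 ≤ i → i ≤ n → 1 ≤ j → j ≤ n → i ≢ j → 1 ≤ res n (+ s j - + s i)
latin-gap-pos {n} {s} (bounded , injective) {i} {j} 1≤i i≤n 1≤j j≤n i≢j = ℕP.n≢0⇒n>0 λ res≡0 →
  i≢j (sym (injective j i 1≤j j≤n 1≤i i≤n
    (≡-mod-ℕ-close (res≡0⇒≡-mod (+ s j) (+ s i) res≡0) (below 1≤j j≤n 1≤i i≤n) (below 1≤i i≤n 1≤j j≤n))))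
  where
  below : ∀ {k l} → 1 ≤ k → k ≤ n → 1 ≤ l → l ≤ n → s k < n + s l
  below {k} {l} 1≤k k≤n 1≤l l≤n =
    ℕP.≤-<-trans (proj₂ (bounded k 1≤k k≤n)) (ℕP.m<m+n n (proj₁ (bounded l 1≤l l≤n)))

[i+k]-[j+k]≡i-j : ∀ i j k → (i +ℤ k) - (j +ℤ k) ≡ i - j
[i+k]-[j+k]≡i-j = solve-∀

[i-k]-[j-k]≡i-j : ∀ i j k → (i - k) - (j - k) ≡ i - j
[i-k]-[j-k]≡i-j = solve-∀

m+n≡o+p⇒m-o≡p-n : ∀ m n o p → m + n ≡ o + p → + m - + o ≡ + p - + n
m+n≡o+p⇒m-o≡p-n m n o p m+n≡o+p = begin
  + m - + o                      ≡⟨ [i+k]-[j+k]≡i-j (+ m) (+ o) (+ n) ⟨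
  (+ m +ℤ + n) - (+ o +ℤ + n)    ≡⟨ cong (_- (+ o +ℤ + n)) sums ⟩
  (+ o +ℤ + p) - (+ o +ℤ + n)    ≡⟨ cong₂ _-_ (ℤP.+-comm (+ o) (+ p)) (ℤP.+-comm (+ o) (+ n)) ⟩
  (+ p +ℤ + o) - (+ n +ℤ + o)    ≡⟨ [i+k]-[j+k]≡i-j (+ p) (+ n) (+ o) ⟩
  + p - + n                      ∎
  where
  open ≡-Reasoning
  sums : + m +ℤ + n ≡ + o +ℤ + p
  sums = trans (sym (ℤP.pos-+ m n)) (trans (cong +_ m+n≡o+p) (ℤP.pos-+ o p))

sumFrom-cong : ∀ {f g : ℕ → ℤ} a k → (∀ j → a ≤ j → j < a + k → f j ≡ g j) →
  sumFrom a k f ≡ sumFrom a k g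
sumFrom-cong a zero f≗g = refl
sumFrom-cong a (suc k) f≗g = cong₂ _+ℤ_
  (f≗g a ℕP.≤-refl (ℕP.m<m+n a ℕP.0<1+n))
  (sumFrom-cong (suc a) k λ j a<j j<1+a+k →
    f≗g j (ℕP.<⇒≤ a<j) (subst (j <_) (sym (ℕP.+-suc a k)) j<1+a+k))

sumFrom-telescope : ∀ (g : ℕ → ℤ) a k → sumFrom a k (λ j → g (suc j) - g j) ≡ g (a + k) - g a
sumFrom-telescope g a zero = begin
  + 0              ≡⟨ ℤP.+-inverseʳ (g a) ⟨
  g a - g a        ≡⟨ cong (λ m → g m - g a) (ℕP.+-identityʳ a) ⟨
  g (a + 0) - g a  ∎
  where open ≡-Reasoning
sumFrom-telescope g a (suc k) = begin
  (g (suc a) - g a) +ℤ sumFrom (suc a) k (λ j → g (suc j) - g j)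
    ≡⟨ cong ((g (suc a) - g a) +ℤ_) (sumFrom-telescope g (suc a) k) ⟩
  (g (suc a) - g a) +ℤ (g (suc a + k) - g (suc a))
    ≡⟨ ℤP.+-comm (g (suc a) - g a) (g (suc a + k) - g (suc a)) ⟩
  (g (suc a + k) - g (suc a)) +ℤ (g (suc a) - g a)
    ≡⟨ ℤP.+-minus-telescope (g (suc a + k)) (g (suc a)) (g a) ⟩
  g (suc a + k) - g a
    ≡⟨ cong (λ m → g m - g a) (ℕP.+-suc a k) ⟨
  g (a + suc k) - g a ∎
  where open ≡-Reasoning

sumRange-telescope : ∀ (g : ℕ → ℤ) a b → a ≤ suc b → sumRange a b (λ j → g (suc j) - g j) ≡ g (suc b) - g a
sumRange-telescope g a b a≤1+b =
  trans (sumFrom-telescope g a (suc b ∸ a)) (cong (λ m → g m - g a) (ℕP.m+[n∸m]≡n a≤1+b))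

module Crossing (n : ℕ) .{{_ : NonZero n}} (r r' : Row) (c c' : ℕ) where

  gap : Row → ℕ → ℕ → ℕ
  gap s i j = res n (+ s j - + s i)

  vgap : ℕ → ℕ
  vgap j = res n (addC r' c' j - addC r c j)

  addC-diff : ∀ s d i j → addC s d j - addC s d i ≡ + s j - + s i
  addC-diff s d i j = begin
    + (s j + d) - + (s i + d)               ≡⟨ cong₂ _-_ (ℤP.pos-+ (s j) d) (ℤP.pos-+ (s i) d) ⟩
    (+ s j +ℤ + d) - (+ s i +ℤ + d)         ≡⟨ [i+k]-[j+k]≡i-j (+ s j) (+ s i) (+ d) ⟩
    + s j - + s i                           ∎
    where open ≡-Reasoning

  -- Both sides are residues of (r'ⱼ + c') − (rᵢ + c): down column i then along r',
  -- or along r then down column j.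
  gap-crossing : ∀ i j → + (gap r' i j + vgap i) ≡ + (gap r i j + vgap j) mod n
  gap-crossing i j = begin
    + (gap r' i j + vgap i)                      ≡⟨ ℤP.pos-+ (gap r' i j) (vgap i) ⟩
    + gap r' i j +ℤ + vgap i                     ≈⟨ ≡-mod-+ (res-≡-mod (+ r' j - + r' i)) (res-≡-mod (X' i - X i)) ⟩
    (+ r' j - + r' i) +ℤ (X' i - X i)            ≡⟨ cong (_+ℤ (X' i - X i)) (addC-diff r' c' i j) ⟨
    (X' j - X' i) +ℤ (X' i - X i)                ≡⟨ reroute (X i) (X' i) (X j) (X' j) ⟩
    (X j - X i) +ℤ (X' j - X j)                  ≡⟨ cong (_+ℤ (X' j - X j)) (addC-diff r c i j) ⟩
    (+ r j - + r i) +ℤ (X' j - X j)              ≈⟨ ≡-mod-+ (res-≡-mod (+ r j - + r i)) (res-≡-mod (X' j - X j)) ⟨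
    + gap r i j +ℤ + vgap j                      ≡⟨ ℤP.pos-+ (gap r i j) (vgap j) ⟨
    + (gap r i j + vgap j)                       ∎
    where
    open Relation.Binary.Reasoning.Setoid (mod-setoid n)
    X X' : ℕ → ℤ
    X = addC r c
    X' = addC r' c'
    reroute : ∀ x x' y y' → (y' - x') +ℤ (x' - x) ≡ (y - x) +ℤ (y' - y)
    reroute = solve-∀

module HalfTurn {n : ℕ} .{{_ : NonZero n}} (b : ℕ) (n≡[1+b]*2 : n ≡ suc b * 2) where

  n≡2+b+b : n ≡ 2 + b + b
  n≡2+b+b = trans n≡[1+b]*2 (double b)
    where
    double : ∀ b → suc b * 2 ≡ 2 + b + b
    double = ℕSolver.solve-∀

  half≡1+b : n / 2 ≡ suc b
  half≡1+b = trans (cong (_/ 2) n≡[1+b]*2) (m*n/n≡m (suc b) 2)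

  b≡half-1 : b ≡ n / 2 ∸ 1
  b≡half-1 = sym (cong (_∸ 1) half≡1+b)

  record NearHalf (v : ℕ) : Set where
    constructor near-half
    field
      lower : b ≤ v
      upper : v ≤ 2 + b

  dist≥⇒near-half : ∀ a a' → n / 2 ∸ 1 ≤ dist n a a' → NearHalf (res n (a' - a))
  dist≥⇒near-half a a' half-1≤dist = near-half b≤y $ ℕP.+-cancelʳ-≤ b y (2 + b) y+b≤2+b+b
    where
    y : ℕ
    y = res n (a' - a)
    bounds : b ≤ y × y + b ≤ n
    bounds = dist≥⇒res-range a a' (subst (_≤ dist n a a') (cong (_∸ 1) half≡1+b) half-1≤dist)
    b≤y : b ≤ y
    b≤y = proj₁ bounds
    y+b≤2+b+b : y + b ≤ 2 + b + b
    y+b≤2+b+b = subst (y + b ≤_) n≡2+b+b (proj₂ bounds)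

  near-half-∣-∣≤2 : ∀ {x y} → NearHalf x → NearHalf y → ∣ + x - + y ∣ ≤ 2
  near-half-∣-∣≤2 {x} {y} x≈ y≈ = case ℕP.≤-total x y of λ where
      (inj₁ x≤y) → ordered x≈ y≈ x≤y
      (inj₂ y≤x) → subst (_≤ 2) (ℤP.∣i-j∣≡∣j-i∣ (+ y) (+ x)) (ordered y≈ x≈ y≤x)
    where
    ordered : ∀ {x y} → NearHalf x → NearHalf y → x ≤ y → ∣ + x - + y ∣ ≤ 2
    ordered {x} {y} (near-half b≤x _) (near-half _ y≤2+b) x≤y = begin
      ∣ + x - + y ∣  ≡⟨ cong ∣_∣ (ℤP.[+m]-[+n]≡m⊖n x y) ⟩
      ∣ x ℤ.⊖ y ∣    ≡⟨ ℤP.∣⊖∣-≤ x≤y ⟩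
      y ∸ x          ≤⟨ ℕP.∸-mono y≤2+b b≤x ⟩
      2 + b ∸ b      ≡⟨ ℕP.m+n∸n≡m 2 b ⟩
      2              ∎
      where open ℕP.≤-Reasoning

  near-half-+-< : 4 < n → ∀ {x y z w} → NearHalf x → NearHalf y → NearHalf z → NearHalf w →
    x + y < n + (z + w)
  near-half-+-< 4<n {x} {y} {z} {w}
    (near-half _ x≤2+b) (near-half _ y≤2+b) (near-half b≤z _) (near-half b≤w _) = begin-strict
    x + y              ≤⟨ ℕP.+-mono-≤ x≤2+b y≤2+b ⟩
    (2 + b) + (2 + b)  ≡⟨ regroup b ⟩
    4 + (b + b)        <⟨ ℕP.+-monoˡ-< (b + b) 4<n ⟩
    n + (b + b)        ≤⟨ ℕP.+-monoʳ-≤ n (ℕP.+-mono-≤ b≤z b≤w) ⟩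
    n + (z + w)        ∎
    where
    open ℕP.≤-Reasoning
    regroup : ∀ b → (2 + b) + (2 + b) ≡ 4 + (b + b)
    regroup = ℕSolver.solve-∀

  near-half-+-cancel : 4 < n → ∀ {x y z w} → NearHalf x → NearHalf y → NearHalf z → NearHalf w →
    + (x + y) ≡ + (z + w) mod n → x + y ≡ z + w
  near-half-+-cancel 4<n x≈ y≈ z≈ w≈ sums≡ =
    ≡-mod-ℕ-close sums≡ (near-half-+-< 4<n x≈ y≈ z≈ w≈) (near-half-+-< 4<n z≈ w≈ x≈ y≈)

  wrap-around : ∀ {u u' y z} → 1 ≤ u → suc u' ≤ n → NearHalf y → NearHalf z →
    n + (u + y) ≤ u' + z → u ≡ 1 × suc u' ≡ n
  wrap-around {u} {u'} {y} {z} 1≤u 1+u'≤n (near-half b≤y _) (near-half _ z≤2+b) wrapped =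
    ℕP.≤-antisym u≤1 1≤u , ℕP.≤-antisym 1+u'≤n n≤1+u'
    where
    open ℕP.≤-Reasoning
    n+u≤1+u'+1 : n + u ≤ suc u' + 1
    n+u≤1+u'+1 = ℕP.+-cancelʳ-≤ b (n + u) (suc u' + 1) (begin
      n + u + b          ≡⟨ ℕP.+-assoc n u b ⟩
      n + (u + b)        ≤⟨ ℕP.+-monoʳ-≤ n (ℕP.+-monoʳ-≤ u b≤y) ⟩
      n + (u + y)        ≤⟨ wrapped ⟩
      u' + z             ≤⟨ ℕP.+-monoʳ-≤ u' z≤2+b ⟩
      u' + (2 + b)       ≡⟨ regroup u' b ⟩
      suc u' + 1 + b     ∎)
      where
      regroup : ∀ u' b → u' + (2 + b) ≡ suc u' + 1 + b
      regroup = ℕSolver.solve-∀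
    u≤1 : u ≤ 1
    u≤1 = ℕP.+-cancelˡ-≤ n u 1 (ℕP.≤-trans n+u≤1+u'+1 (ℕP.+-monoˡ-≤ 1 1+u'≤n))
    n≤1+u' : n ≤ suc u'
    n≤1+u' = ℕP.+-cancelʳ-≤ 1 n (suc u') (ℕP.≤-trans (ℕP.+-monoʳ-≤ n 1≤u) n+u≤1+u'+1)

  wrap-ends : ∀ {u u'} → u ≡ 1 → suc u' ≡ n → + u - + (n / 2) ≡ - + b × + u' - + (n / 2) ≡ + b
  wrap-ends {u' = u'} refl 1+u'≡n rewrite half≡1+b = low , high
    where
    u'≡1+b+b : u' ≡ suc b + b
    u'≡1+b+b = ℕP.suc-injective (trans 1+u'≡n n≡2+b+b)
    low : + 1 - + suc b ≡ - + b
    low = trans (cong (λ m → + 1 - m) (ℤP.pos-+ 1 b)) (cancel (+ b))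
      where
      cancel : ∀ b → + 1 - (+ 1 +ℤ b) ≡ - b
      cancel = solve-∀
    high : + u' - + suc b ≡ + b
    high = begin
      + u' - + suc b               ≡⟨ cong (λ m → + m - + suc b) u'≡1+b+b ⟩
      + (suc b + b) - + suc b      ≡⟨ cong (_- + suc b) (ℤP.pos-+ (suc b) b) ⟩
      (+ suc b +ℤ + b) - + suc b   ≡⟨ cancel (+ suc b) (+ b) ⟩
      + b                          ∎
      where
      open ≡-Reasoning
      cancel : ∀ s b → (s +ℤ b) - s ≡ b
      cancel = solve-∀

  close-or-opposite : ∀ {u u' y z} → 1 ≤ u → 1 ≤ u' → u < n → u' < n → NearHalf y → NearHalf z →
    + (u' + y) ≡ + (u + z) mod n →
    (∣ (+ u - + (n / 2)) - (+ u' - + (n / 2)) ∣ ≤ 2) ⊎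
    (∣ + u - + (n / 2) ∣ ≡ n / 2 ∸ 1 × + u' - + (n / 2) ≡ - (+ u - + (n / 2)))
  close-or-opposite {u} {u'} {y} {z} 1≤u 1≤u' u<n u'<n y≈ z≈ sums≡ with ≡-mod-ℕ-cases sums≡
  ... | inj₁ sums≡ = inj₁ (begin
    ∣ (+ u - + (n / 2)) - (+ u' - + (n / 2)) ∣  ≡⟨ cong ∣_∣ ([i-k]-[j-k]≡i-j (+ u) (+ u') (+ (n / 2))) ⟩
    ∣ + u - + u' ∣                              ≡⟨ ℤP.∣i-j∣≡∣j-i∣ (+ u) (+ u') ⟩
    ∣ + u' - + u ∣                              ≡⟨ cong ∣_∣ (m+n≡o+p⇒m-o≡p-n u' y u z sums≡) ⟩
    ∣ + z - + y ∣                               ≤⟨ near-half-∣-∣≤2 z≈ y≈ ⟩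
    2                                           ∎)
    where open ℕP.≤-Reasoning
  ... | inj₂ (inj₁ u-wraps) with wrap-around 1≤u u'<n z≈ y≈ u-wraps
  ...   | u≡1 , 1+u'≡n with wrap-ends u≡1 1+u'≡n
  ...     | h≡-b , h'≡b = inj₂
    ( trans (cong ∣_∣ h≡-b) (trans (ℤP.∣-i∣≡∣i∣ (+ b)) b≡half-1)
    , trans h'≡b (sym (trans (cong -_ h≡-b) (ℤP.neg-involutive (+ b)))))
  close-or-opposite 1≤u 1≤u' u<n u'<n y≈ z≈ _ | inj₂ (inj₂ u'-wraps) with wrap-around 1≤u' u<n y≈ z≈ u'-wraps
  ...   | u'≡1 , 1+u≡n with wrap-ends u'≡1 1+u≡n
  ...     | h'≡-b , h≡b = inj₂ (trans (cong ∣_∣ h≡b) b≡half-1 , trans h'≡-b (cong -_ (sym h≡b)))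

module NeighbourRows {n : ℕ} .{{_ : NonZero n}} (b : ℕ) (n≡[1+b]*2 : n ≡ suc b * 2) (6≤n : 6 ≤ n)
  {r r' : Row} {c c' : ℕ}
  (latin : LatinRow n r) (inner : MaxInnerDist n r)
  (latin' : LatinRow n r') (inner' : MaxInnerDist n r')
  (vertical : ∀ j → 1 ≤ j → j ≤ n → n / 2 ∸ 1 ≤ dist n (addC r c j) (addC r' c' j)) where

  open HalfTurn b n≡[1+b]*2
  open Crossing n r r' c c'

  4<n : 4 < n
  4<n = ℕP.≤-trans (ℕP.n≤1+n 5) 6≤n

  1≤n : 1 ≤ n
  1≤n = ℕP.≤-trans (s≤s z≤n) 6≤n

  n≢1 : n ≢ 1
  n≢1 = ℕP.>⇒≢ (ℕP.≤-trans (ℕP.m≤m+n 2 4) 6≤n)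

  vgap-near-half : ∀ j → 1 ≤ j → j ≤ n → NearHalf (vgap j)
  vgap-near-half j 1≤j j≤n = dist≥⇒near-half (addC r c j) (addC r' c' j) (vertical j 1≤j j≤n)

  hDiff-near-half : ∀ s → MaxInnerDist n s → ∀ j → 1 ≤ j → j ≤ n ∸ 1 → NearHalf (hDiff n s j)
  hDiff-near-half s inner-s j 1≤j j≤n-1 = dist≥⇒near-half (+ s j) (+ s (suc j)) (inner-s j 1≤j j≤n-1)

  eps-diff-telescopes : ∀ j → 1 ≤ j → j ≤ n ∸ 1 → eps n r' j - eps n r j ≡ + vgap (suc j) - + vgap j
  eps-diff-telescopes j 1≤j j≤n-1 = begin
    eps n r' j - eps n r j              ≡⟨ [i-k]-[j-k]≡i-j (+ hDiff n r' j) (+ hDiff n r j) (+ (n / 2)) ⟩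
    + hDiff n r' j - + hDiff n r j      ≡⟨ m+n≡o+p⇒m-o≡p-n (hDiff n r' j) (vgap j) (hDiff n r j) (vgap (suc j)) squares ⟩
    + vgap (suc j) - + vgap j           ∎
    where
    open ≡-Reasoning
    1+j≤n : suc j ≤ n
    1+j≤n = ℕP.m≤pred[n]⇒suc[m]≤n j≤n-1
    squares : hDiff n r' j + vgap j ≡ hDiff n r j + vgap (suc j)
    squares = near-half-+-cancel 4<n
      (hDiff-near-half r' inner' j 1≤j j≤n-1) (vgap-near-half j 1≤j (ℕP.<⇒≤ 1+j≤n))
      (hDiff-near-half r inner j 1≤j j≤n-1) (vgap-near-half (suc j) (s≤s z≤n) 1+j≤n)
      (gap-crossing j (suc j))

  partial-sums-bounded : ∀ j₁ j₂ → 1 ≤ j₁ → j₁ ≤ j₂ → j₂ ≤ n ∸ 1 →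
    ∣ sumRange j₁ j₂ (λ j → eps n r' j - eps n r j) ∣ ≤ 2
  partial-sums-bounded j₁ j₂ 1≤j₁ j₁≤j₂ j₂≤n-1 =
    subst (λ t → ∣ t ∣ ≤ 2) (sym telescoped)
      (near-half-∣-∣≤2 (vgap-near-half (suc j₂) (s≤s z≤n) 1+j₂≤n)
                     (vgap-near-half j₁ 1≤j₁ (ℕP.≤-trans j₁≤j₂ (ℕP.<⇒≤ 1+j₂≤n))))
    where
    1+j₂≤n : suc j₂ ≤ n
    1+j₂≤n = ℕP.m≤pred[n]⇒suc[m]≤n j₂≤n-1
    j₁≤1+j₂ : j₁ ≤ suc j₂
    j₁≤1+j₂ = ℕP.≤-trans j₁≤j₂ (ℕP.n≤1+n j₂)
    in-range : ∀ j → j₁ ≤ j → j < j₁ + (suc j₂ ∸ j₁) →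
      eps n r' j - eps n r j ≡ + vgap (suc j) - + vgap j
    in-range j j₁≤j j<end = eps-diff-telescopes j (ℕP.≤-trans 1≤j₁ j₁≤j)
      (ℕP.≤-trans (ℕP.≤-pred (subst (j <_) (ℕP.m+[n∸m]≡n j₁≤1+j₂) j<end)) j₂≤n-1)
    telescoped : sumRange j₁ j₂ (λ j → eps n r' j - eps n r j) ≡ + vgap (suc j₂) - + vgap j₁
    telescoped = trans (sumFrom-cong j₁ (suc j₂ ∸ j₁) in-range)
                       (sumRange-telescope (λ j → + vgap j) j₁ j₂ j₁≤1+j₂)

  ends-close-or-opposite :
    (∣ hLast n r - hLast n r' ∣ ≤ 2) ⊎ (∣ hLast n r ∣ ≡ n / 2 ∸ 1 × hLast n r' ≡ - hLast n r)
  ends-close-or-opposite = close-or-opposite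
    (latin-gap-pos latin 1≤n ℕP.≤-refl ℕP.≤-refl 1≤n n≢1) (latin-gap-pos latin' 1≤n ℕP.≤-refl ℕP.≤-refl 1≤n n≢1)
    (res<n (+ r 1 - + r n)) (res<n (+ r' 1 - + r' n))
    (vgap-near-half n 1≤n ℕP.≤-refl) (vgap-near-half 1 ℕP.≤-refl 1≤n)
    (gap-crossing n 1)

mainTheorem15 : (n : ℕ) .{{_ : NonZero n}} → 2 ∣ n → 6 ≤ n →
    (r r' : Row) → Neighbors n r r' → ¬ SameExtDiff n r r' →
    (∀ j₁ j₂ → 1 ≤ j₁ → j₁ ≤ j₂ → j₂ ≤ n ∸ 1 →
      ∣ sumRange j₁ j₂ (λ j → eps n r' j - eps n r j) ∣ ≤ 2)
    × ((∣ hLast n r - hLast n r' ∣ ≤ 2)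
       ⊎ (∣ hLast n r ∣ ≡ n / 2 ∸ 1 × hLast n r' ≡ - hLast n r))
mainTheorem15 n (divides zero n≡0) 6≤n _ _ _ _ = contradiction (subst (6 ≤_) n≡0 6≤n) λ ()
mainTheorem15 n (divides (suc b) n≡[1+b]*2) 6≤n r r'
  (latin , _ , inner , latin' , _ , inner' , c , c' , _ , _ , (_ , _ , _ , _ , _ , vertical)) _ =
  partial-sums-bounded , ends-close-or-opposite
  where open NeighbourRows b n≡[1+b]*2 6≤n latin inner latin' inner' vertical
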